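{- Let $b\ge2$ and $q\ge 3$ be integers with $2q\le b/\ln b$. Let $T$ be a complete $b$-ary tree, let $x$ be a proper $q$-colouring of $T$ chosen uniformly at random, let $v$ be a vertex of $T$ at height $h$, and let $u_h=\Pr(v\notin F(x))$. Then $u_h\leq 1/b$.
   Context: The complete $b$-ary tree of height $H$ has a root, every non-leaf vertex has $b$ children and every root-to-leaf path has $H$ edges. The height $h(v)$ of a vertex is the number of edges on a path from $v$ down to a leaf. For a vertex $w$, $T_w$ is the subtree rooted at $w$ and $L(T_w)$ its set of leaves. A proper $q$-colouring uses colours $[q]=\{0,\dots,q-1\}$ with adjacent vertices coloured differently; $\Omega(T_w)$ is the set of proper $q$-colourings of $T_w$ and $\Omega$ that of $T$. For $x\in\Omega$, $F(x)$ is the set of vertices $w$ such that every $y\in\Omega(T_w)$ with $y(L(T_w))=x(L(T_w))$ satisfies $y(w)=x(w)$ (the colour of $w$ is forced by the colours $x$ gives to the leaves below $w$). The probability $u_h$ does not depend on the choice of $v$ at height $h$. -}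

module Defs where

open import Data.Nat using (ℕ; zero; suc; _+_; _*_; _^_; _≤_; _!)
open import Data.Product using (∃)
open import Data.Fin using (Fin; _≟_)
open import Data.Bool using (Bool; true; false; _∧_; _∨_; not; if_then_else_)
open import Data.List using (List; []; _∷_; [_]; map; concatMap; _++_; length; filter; allFin)
import Data.List as L
open import Data.List.Properties using (≡-dec)
open import Data.Vec using (Vec; []; _∷_; lookup)
open import Relation.Nullary using (does)
open import Data.Bool.Properties using (T?)

-- A q-colouring of the complete b-ary tree of height h, as a labelled tree:
-- each vertex carries a colour in Fin q = [q]; internal vertices have b children.
data Col (q b : ℕ) : ℕ → Set where
  leaf : Fin q → Col q b 0
  node : ∀ {h} → Fin q → Vec (Col q b h) b → Col q b (suc h)

module _ {q b : ℕ} where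

  root : ∀ {h} → Col q b h → Fin q
  root (leaf c)   = c
  root (node c _) = c

  leavesV : ∀ {n} h → Vec (Col q b h) n → List (Fin q)
  leaves  : ∀ h → Col q b h → List (Fin q)
  leaves zero    (leaf c)    = [ c ]
  leaves (suc h) (node _ cs) = leavesV h cs
  leavesV h []       = []
  leavesV h (x ∷ xs) = leaves h x ++ leavesV h xs

  properV : ∀ {n} h → Fin q → Vec (Col q b h) n → Bool
  proper  : ∀ h → Col q b h → Bool
  proper zero    (leaf c)    = true
  proper (suc h) (node c cs) = properV h c cs
  properV h c []       = true
  properV h c (x ∷ xs) = not (does (c ≟ root x)) ∧ proper h x ∧ properV h c xs

  allVecs : ∀ {A : Set} → List A → (n : ℕ) → List (Vec A n)
  allVecs xs zero    = [ [] ]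
  allVecs xs (suc n) = concatMap (λ x → map (x ∷_) (allVecs xs n)) xs

  allCol : ∀ h → List (Col q b h)
  allCol zero    = map leaf (allFin q)
  allCol (suc h) = concatMap (λ c → map (node c) (allVecs (allCol h) b)) (allFin q)

  Ω : ∀ h → List (Col q b h)
  Ω h = filter (λ x → T? (proper h x)) (allCol h)

  -- the subtree T_w of a colouring at the vertex reached by a root-to-w path
  sub : ∀ d {h} → Vec (Fin b) d → Col q b (d + h) → Col q b h
  sub zero    []      x           = x
  sub (suc d) (i ∷ p) (node _ cs) = sub d p (lookup cs i)

  -- w ∈ F(x), for x restricted to T_w: every proper colouring y of T_w with the
  -- same leaf colours as x gives w the same colour as x does
  forced : ∀ h → Col q b h → Bool
  forced h x = L.foldr (λ y r → (not (does (≡-dec _≟_ (leaves h y) (leaves h x)))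
                            ∨ does (root y ≟ root x)) ∧ r) true (Ω h)

-- S b N = Σ_{k=0}^{N} b^k · N!/k!, so S b N / N! is the N-th partial sum of e^b
S : ℕ → ℕ → ℕ
S b zero    = 1
S b (suc N) = suc N * S b N + b ^ suc N

-- 2q ≤ b / ln b  (for b ≥ 2)  ⇔  b^(2q) ≤ e^b  ⇔  ∃ N. b^(2q) ≤ Σ_{k≤N} b^k/k!
-- (the last step since e^b is irrational and the strictly increasing limit of its partial sums)
ExpCond : ℕ → ℕ → Set
ExpCond b q = ∃ λ N → b ^ (2 * q) * N ! ≤ S b N

module Submission where

-- Let ω h be the number of proper colourings of the height-h tree with a given root colour, so
-- ω (h + 1) = (Q · ω h)^b with Q = q − 1, and let G h c count those with root colour c whose root
-- is not forced by the leaves. If the root of x (colour c) is not forced, some proper y with the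
-- same leaves has root colour c' ≠ c, and then no child of x is forced to have colour c'. Among
-- the Q · ω h proper children under c, those forced to c' number ω h − G h c', so by induction
-- b · G h ≤ ω h gives G (h + 1) c ≤ Q (r · ω h / b)^b with r = bQ − b + 1, and the induction
-- closes because bQ (r / bQ)^b ≤ 1. That inequality is where 2q ≤ b / ln b enters, through
-- (1 − b/L)^L ≤ e^(−b) ≤ b^(−2q). A vertex deeper down is handled by conditioning on the colour
-- of its parent: the children of a vertex are independent given its colour.

open import Defs
open import Data.Nat using (ℕ; zero; suc; _+_; _*_; _^_; _≤_; _<_; _≤?_; _≰_; z≤n; s≤s; NonZero; _!)
open import Data.Nat.Properties hiding (_≟_)
open import Data.Nat.Tactic.RingSolver using (solve-∀)
open import Data.Bool using (Bool; true; false; _∧_; _∨_; not; if_then_else_)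
open import Data.Bool.Properties
  using (T?; T-≡; ∧-assoc; ∧-identityʳ; ∧-zeroʳ; ∧-conicalˡ; ∧-conicalʳ; ∨-conicalˡ; ∨-conicalʳ; not-injective; ∧-commutativeMonoid)
open import Data.Fin using (Fin; zero; suc; _≟_; punchIn)
open import Data.Fin.Properties using (punchInᵢ≢i)
open import Data.List using (List; []; _∷_; map; concatMap; _++_; length; filter; tabulate; allFin; foldr)
open import Data.List.Properties using (∷-injective; ∷-injectiveˡ; length-++; ≡-dec)
open import Data.List.Membership.Propositional using (_∈_; lose)
open import Data.List.Membership.Propositional.Properties
  using (∈-map⁺; ∈-concatMap⁺; ∈-allFin; ∈-filter⁺; ∈-filter⁻)
open import Data.List.Relation.Unary.Any using (here; there)
open import Data.Vec as Vec using (Vec; []; _∷_; lookup)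
open import Data.Vec.Functional using (removeAt)
open import Data.Product using (Σ; _×_; _,_)
open import Data.Empty using (⊥-elim)
open import Function using (_∘_; id; Equivalence)
open import Relation.Nullary using (Dec; does; yes; no)
open import Relation.Nullary.Decidable using (dec-true; dec-false)
open import Relation.Nullary.Negation using (contradiction)
open import Relation.Binary.PropositionalEquality
open import Algebra.Bundles using (CommutativeMonoid)
open import Algebra.Properties.Semiring.Sum +-*-semiring
  using (sum; sum-syntax; sum-cong-≗; sum-remove; ∑-distrib-+; *-distribˡ-sum)
open import Algebra.Properties.CommutativeSemigroup *-commutativeSemigroup using (x∙yz≈y∙xz)
open import Algebra.Properties.CommutativeSemigroup (CommutativeMonoid.commutativeSemigroup ∧-commutativeMonoid)
  using (xy∙z≈xz∙y)

private variable
  A B : Set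
  n : ℕ

-- Counting with Boolean predicates

_==_ : Fin n → Fin n → Bool
a == c = does (a ≟ c)

==-refl : (a : Fin n) → (a == a) ≡ true
==-refl a = dec-true (a ≟ a) refl

==-sym : (a c : Fin n) → (a == c) ≡ (c == a)
==-sym a c with a ≟ c | c ≟ a
... | yes _   | yes _   = refl
... | no _    | no _    = refl
... | yes a≡c | no c≢a  = ⊥-elim (c≢a (sym a≡c))
... | no a≢c  | yes c≡a = ⊥-elim (a≢c (sym c≡a))

does⇒ : {P : Set} (d : Dec P) → does d ≡ true → P
does⇒ (yes p) _ = p

==⇒≡ : {a c : Fin n} → (a == c) ≡ true → a ≡ c
==⇒≡ {a = a} {c} = does⇒ (a ≟ c)

==-false⇒≢ : {a c : Fin n} → (a == c) ≡ false → a ≢ c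
==-false⇒≢ {a = a} {c} eq a≡c with () ← trans (sym (dec-true (a ≟ c) a≡c)) eq

∑-const : ∀ n k → ∑[ i < n ] k ≡ n * k
∑-const zero    k = refl
∑-const (suc n) k = cong (k +_) (∑-const n k)

∑-mono-≤ : {f g : Fin n → ℕ} → (∀ i → f i ≤ g i) → sum f ≤ sum g
∑-mono-≤ {zero}  f≤g = z≤n
∑-mono-≤ {suc n} f≤g = +-mono-≤ (f≤g zero) (∑-mono-≤ (f≤g ∘ suc))

≤-∑ : (f : Fin n → ℕ) (i : Fin n) → f i ≤ sum f
≤-∑ {suc n} f i = ≤-trans (m≤m+n (f i) _) (≤-reflexive (sym (sum-remove f)))

∑-punctured : (a : Fin (suc n)) (x y : ℕ) → ∑[ c < suc n ] (if a == c then x else y) ≡ x + n * y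
∑-punctured {n} a x y = begin
  sum t                      ≡⟨ sum-remove t ⟩
  t a + sum (removeAt t a)    ≡⟨ cong₂ _+_ (cong (if_then x else y) (==-refl a)) (sum-cong-≗ off-a) ⟩
  x + ∑[ i < n ] y            ≡⟨ cong (x +_) (∑-const n y) ⟩
  x + n * y                  ∎
  where
  open ≡-Reasoning
  t = λ c → if a == c then x else y
  off-a : ∀ i → removeAt t a i ≡ y
  off-a i = cong (if_then x else y) (dec-false (a ≟ punchIn a i) (punchInᵢ≢i a i ∘ sym))

indicator : Bool → ℕ
indicator b = if b then 1 else 0

count : (A → Bool) → List A → ℕ
count f []       = 0
count f (x ∷ xs) = indicator (f x) + count f xs

module _ {f : A → Bool} where

  length-filter : (xs : List A) → length (filter (T? ∘ f) xs) ≡ count f xs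
  length-filter []       = refl
  length-filter (x ∷ xs) with f x
  ... | true  = cong suc (length-filter xs)
  ... | false = length-filter xs

  count-filter : (g : A → Bool) (xs : List A) →
                 count g (filter (T? ∘ f) xs) ≡ count (λ x → f x ∧ g x) xs
  count-filter g []       = refl
  count-filter g (x ∷ xs) with f x
  ... | true  = cong (indicator (g x) +_) (count-filter g xs)
  ... | false = count-filter g xs

  count-cong : {g : A → Bool} → (∀ x → f x ≡ g x) → (xs : List A) → count f xs ≡ count g xs
  count-cong f≗g []       = refl
  count-cong f≗g (x ∷ xs) = cong₂ _+_ (cong indicator (f≗g x)) (count-cong f≗g xs)

  count-++ : (xs ys : List A) → count f (xs ++ ys) ≡ count f xs + count f ys
  count-++ []       ys = refl
  count-++ (x ∷ xs) ys = trans (cong (indicator (f x) +_) (count-++ xs ys)) (sym (+-assoc (indicator (f x)) (count f xs) (count f ys)))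

  count-map : (g : B → A) (xs : List B) → count f (map g xs) ≡ count (f ∘ g) xs
  count-map g []       = refl
  count-map g (x ∷ xs) = cong (indicator (f (g x)) +_) (count-map g xs)

  count-split : (g : A → Bool) (xs : List A) →
                count f xs ≡ count (λ x → f x ∧ g x) xs + count (λ x → f x ∧ not (g x)) xs
  count-split g []       = refl
  count-split g (x ∷ xs) with f x | g x
  ... | true  | true  = cong suc (count-split g xs)
  ... | true  | false = trans (cong suc (count-split g xs)) (sym (+-suc _ _))
  ... | false | _     = count-split g xs

count-false : (xs : List A) → count (λ _ → false) xs ≡ 0
count-false []       = refl
count-false (x ∷ xs) = count-false xs

count-∧ˡ : (b : Bool) (f : A → Bool) (xs : List A) →
           count (λ x → b ∧ f x) xs ≡ (if b then count f xs else 0)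
count-∧ˡ true  f xs = refl
count-∧ˡ false f xs = count-false xs

count-concatMap : {f : B → Bool} {g : A → List B} (p : A → Bool) (k : ℕ) →
                  (∀ x → count f (g x) ≡ (if p x then k else 0)) →
                  (xs : List A) → count f (concatMap g xs) ≡ count p xs * k
count-concatMap p k fiber []       = refl
count-concatMap {f = f} {g} p k fiber (x ∷ xs) = begin
  count f (g x ++ concatMap g xs)              ≡⟨ count-++ (g x) (concatMap g xs) ⟩
  count f (g x) + count f (concatMap g xs)     ≡⟨ cong₂ _+_ (fiber x) (count-concatMap p k fiber xs) ⟩
  (if p x then k else 0) + count p xs * k      ≡⟨ lemma (p x) ⟩
  (indicator (p x) + count p xs) * k           ∎
  where
  open ≡-Reasoning
  lemma : ∀ b → (if b then k else 0) + count p xs * k ≡ (indicator b + count p xs) * k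
  lemma true  = refl
  lemma false = refl

count-allFin : (f : Fin n → Bool) → count f (allFin n) ≡ ∑[ i < n ] indicator (f i)
count-allFin f = count-tabulate f id
  where
  count-tabulate : ∀ {n} (f : A → Bool) (g : Fin n → A) → count f (tabulate g) ≡ ∑[ i < n ] indicator (f (g i))
  count-tabulate {n = zero}  f g = refl
  count-tabulate {n = suc n} f g = cong (indicator (f (g zero)) +_) (count-tabulate f (g ∘ suc))

count-byKey : (κ : A → Fin (suc n)) (f : A → Bool) (xs : List A) →
              count f xs ≡ ∑[ c < suc n ] count (λ x → f x ∧ κ x == c) xs
count-byKey {n = n} κ f []       = sym (trans (∑-const (suc n) 0) (*-zeroʳ n))
count-byKey {n = n} κ f (x ∷ xs) = begin
  indicator (f x) + count f xs
    ≡⟨ cong₂ _+_ (sym (indicator-split (f x))) (count-byKey κ f xs) ⟩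
  ∑[ c < suc n ] indicator (f x ∧ κ x == c) + ∑[ c < suc n ] count (λ y → f y ∧ κ y == c) xs
    ≡⟨ sym (∑-distrib-+ (λ c → indicator (f x ∧ κ x == c)) (λ c → count (λ y → f y ∧ κ y == c) xs)) ⟩
  ∑[ c < suc n ] count (λ y → f y ∧ κ y == c) (x ∷ xs) ∎
  where
  open ≡-Reasoning
  indicator-split : ∀ b → ∑[ c < suc n ] indicator (b ∧ κ x == c) ≡ indicator b
  indicator-split true  = trans (∑-punctured (κ x) 1 0) (cong suc (*-zeroʳ n))
  indicator-split false = trans (∑-const (suc n) 0) (*-zeroʳ n)

count-≤-∑ : {f : A → Bool} (g : Fin n → A → Bool) →
            (∀ x → f x ≡ true → Σ (Fin n) λ c → g c x ≡ true) →
            (xs : List A) → count f xs ≤ ∑[ c < n ] count (g c) xs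
count-≤-∑ g cover []       = z≤n
count-≤-∑ {f = f} g cover (x ∷ xs) = begin
  indicator (f x) + count f xs
    ≤⟨ +-mono-≤ covered (count-≤-∑ g cover xs) ⟩
  ∑[ c < _ ] indicator (g c x) + ∑[ c < _ ] count (g c) xs
    ≡⟨ sym (∑-distrib-+ (λ c → indicator (g c x)) (λ c → count (g c) xs)) ⟩
  ∑[ c < _ ] count (g c) (x ∷ xs) ∎
  where
  open ≤-Reasoning
  covered : indicator (f x) ≤ ∑[ c < _ ] indicator (g c x)
  covered with f x in fx
  ... | false = z≤n
  ... | true with c , gcx ← cover x fx =
    ≤-trans (≤-reflexive (cong indicator (sym gcx))) (≤-∑ (λ c → indicator (g c x)) c)

count-==-allFin : (a : Fin (suc n)) → count (_== a) (allFin (suc n)) ≡ 1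
count-==-allFin {n} a = begin
  count (_== a) (allFin (suc n))              ≡⟨ count-allFin (_== a) ⟩
  ∑[ c < suc n ] indicator (c == a)           ≡⟨ sum-cong-≗ (λ c → cong indicator (==-sym c a)) ⟩
  ∑[ c < suc n ] (if a == c then 1 else 0)    ≡⟨ ∑-punctured a 1 0 ⟩
  1 + n * 0                                   ≡⟨ cong suc (*-zeroʳ n) ⟩
  1                                           ∎
  where open ≡-Reasoning

*-count-≤-∑ : {f : A → Bool} (κ : A → Fin (suc n)) (k : ℕ) {g : Fin (suc n) → ℕ} →
              (xs : List A) → (∀ c → k * count (λ x → f x ∧ κ x == c) xs ≤ g c) → k * count f xs ≤ sum g
*-count-≤-∑ {f = f} κ k {g} xs bound = begin
  k * count f xs                                 ≡⟨ cong (k *_) (count-byKey κ f xs) ⟩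
  k * (∑[ c < _ ] count (λ x → f x ∧ κ x == c) xs) ≡⟨ *-distribˡ-sum k (λ c → count (λ x → f x ∧ κ x == c) xs) ⟩
  ∑[ c < _ ] (k * count (λ x → f x ∧ κ x == c) xs) ≤⟨ ∑-mono-≤ bound ⟩
  sum g                                          ∎
  where open ≤-Reasoning

module _ (g : A → Bool) where

  foldr-∧-true⇒∈ : ∀ {xs} → foldr (λ y r → g y ∧ r) true xs ≡ true → ∀ {y} → y ∈ xs → g y ≡ true
  foldr-∧-true⇒∈ {x ∷ xs} all (here refl) = ∧-conicalˡ (g x) _ all
  foldr-∧-true⇒∈ {x ∷ xs} all (there y∈xs) = foldr-∧-true⇒∈ (∧-conicalʳ (g x) _ all) y∈xs

  foldr-∧-false⇒∃ : ∀ xs → foldr (λ y r → g y ∧ r) true xs ≡ false → Σ A λ y → y ∈ xs × g y ≡ false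
  foldr-∧-false⇒∃ (x ∷ xs) some with g x in gx
  ... | false = x , here refl , gx
  ... | true with y , y∈xs , gy ← foldr-∧-false⇒∃ xs some = y , there y∈xs , gy

++-injective : (xs xs′ : List A) {ys ys′ : List A} → length xs ≡ length xs′ →
               xs ++ ys ≡ xs′ ++ ys′ → xs ≡ xs′ × ys ≡ ys′
++-injective []       []        _   eq = refl , eq
++-injective (x ∷ xs) (x′ ∷ xs′) len eq with refl , eq′ ← ∷-injective eq
  with refl , rest ← ++-injective xs xs′ (suc-injective len) eq′ = refl , rest

allVecs-complete : {q b : ℕ} {xs : List A} → (∀ x → x ∈ xs) → (v : Vec A n) → v ∈ allVecs {q} {b} xs n
allVecs-complete complete []      = here refl
allVecs-complete {A = A} {n = suc n} {q = q} {b} {xs} complete (x ∷ v) =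
  ∈-concatMap⁺ extend (lose {P = λ y → x ∷ v ∈ extend y} (complete x) (∈-map⁺ (Vec._∷_ x) (allVecs-complete {q = q} {b} complete v)))
  where extend : A → List (Vec A (suc n))
        extend y = map (y ∷_) (allVecs {q} {b} xs n)

allᵇ : (A → Bool) → Vec A n → Bool
allᵇ f []       = true
allᵇ f (x ∷ xs) = f x ∧ allᵇ f xs

-- allVecs takes the tree parameters q and b as implicit arguments that it does not use.
module _ {q b : ℕ} (f : A → Bool) (xs : List A) where

  private
    vecs : ∀ n → List (Vec A n)
    vecs = allVecs {q} {b} xs

  count-allVecs-allᵇ : ∀ n → count (allᵇ f) (vecs n) ≡ count f xs ^ n
  count-allVecs-allᵇ zero    = refl
  count-allVecs-allᵇ (suc n) =
    trans (count-concatMap f _ fiber xs) (cong (count f xs *_) (count-allVecs-allᵇ n))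
    where
    fiber : ∀ x → count (allᵇ f) (map (x ∷_) (vecs n)) ≡ (if f x then count (allᵇ f) (vecs n) else 0)
    fiber x = trans (count-map (x ∷_) (vecs n)) (count-∧ˡ (f x) (allᵇ f) (vecs n))

  count-allVecs-lookup : (g : A → Bool) (m : ℕ) (i : Fin (suc m)) →
    count (λ cs → allᵇ f cs ∧ g (lookup cs i)) (vecs (suc m)) ≡ count (λ x → f x ∧ g x) xs * count f xs ^ m
  count-allVecs-lookup g m zero =
    trans (count-concatMap (λ x → f x ∧ g x) _ fiber xs) (cong (count (λ x → f x ∧ g x) xs *_) (count-allVecs-allᵇ m))
    where
    fiber : ∀ x → count (λ cs → allᵇ f cs ∧ g (lookup cs zero)) (map (x ∷_) (vecs m))
                    ≡ (if f x ∧ g x then count (allᵇ f) (vecs m) else 0)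
    fiber x = trans (count-map (x ∷_) (vecs m)) (split (f x) (g x))
      where
      split : ∀ a c → count (λ cs → (a ∧ allᵇ f cs) ∧ c) (vecs m) ≡ (if a ∧ c then count (allᵇ f) (vecs m) else 0)
      split false _     = count-false (vecs m)
      split true  false = trans (count-cong (λ cs → ∧-zeroʳ (allᵇ f cs)) (vecs m)) (count-false (vecs m))
      split true  true  = count-cong (λ cs → ∧-identityʳ (allᵇ f cs)) (vecs m)
  count-allVecs-lookup g (suc m) (suc i) = begin
    count (λ cs → allᵇ f cs ∧ g (lookup cs (suc i))) (vecs (suc (suc m)))
      ≡⟨ count-concatMap f _ fiber xs ⟩
    count f xs * (count (λ x → f x ∧ g x) xs * count f xs ^ m)
      ≡⟨ x∙yz≈y∙xz (count f xs) (count (λ x → f x ∧ g x) xs) (count f xs ^ m) ⟩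
    count (λ x → f x ∧ g x) xs * count f xs ^ suc m ∎
    where
    open ≡-Reasoning
    fiber : ∀ x → count (λ cs → allᵇ f cs ∧ g (lookup cs (suc i))) (map (x ∷_) (vecs (suc m)))
                    ≡ (if f x then count (λ x → f x ∧ g x) xs * count f xs ^ m else 0)
    fiber x = begin
      count (λ cs → allᵇ f cs ∧ g (lookup cs (suc i))) (map (x ∷_) (vecs (suc m)))
        ≡⟨ count-map (x ∷_) (vecs (suc m)) ⟩
      count (λ cs → (f x ∧ allᵇ f cs) ∧ g (lookup cs i)) (vecs (suc m))
        ≡⟨ count-cong (λ cs → ∧-assoc (f x) (allᵇ f cs) (g (lookup cs i))) (vecs (suc m)) ⟩
      count (λ cs → f x ∧ (allᵇ f cs ∧ g (lookup cs i))) (vecs (suc m))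
        ≡⟨ count-∧ˡ (f x) (λ cs → allᵇ f cs ∧ g (lookup cs i)) (vecs (suc m)) ⟩
      (if f x then count (λ cs → allᵇ f cs ∧ g (lookup cs i)) (vecs (suc m)) else 0)
        ≡⟨ cong (if f x then_else 0) (count-allVecs-lookup g m i) ⟩
      (if f x then count (λ x → f x ∧ g x) xs * count f xs ^ m else 0) ∎

  allVecs-lookup-≤ : (g : A → Bool) (k : ℕ) → k * count (λ x → f x ∧ g x) xs ≤ count f xs →
    (i : Fin n) → k * count (λ cs → allᵇ f cs ∧ g (lookup cs i)) (vecs n) ≤ count (allᵇ f) (vecs n)
  allVecs-lookup-≤ {n = suc m} g k k∣g∣≤∣f∣ i = begin
    k * count (λ cs → allᵇ f cs ∧ g (lookup cs i)) (vecs (suc m))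
      ≡⟨ cong (k *_) (count-allVecs-lookup g m i) ⟩
    k * (count (λ x → f x ∧ g x) xs * count f xs ^ m)
      ≡⟨ sym (*-assoc k (count (λ x → f x ∧ g x) xs) (count f xs ^ m)) ⟩
    k * count (λ x → f x ∧ g x) xs * count f xs ^ m
      ≤⟨ *-monoˡ-≤ (count f xs ^ m) k∣g∣≤∣f∣ ⟩
    count f xs ^ suc m
      ≡⟨ sym (count-allVecs-allᵇ (suc m)) ⟩
    count (allᵇ f) (vecs (suc m)) ∎
    where open ≤-Reasoning

-- The exponential condition

^-distribʳ-* : ∀ m n k → (m * n) ^ k ≡ m ^ k * n ^ k
^-distribʳ-* m n zero    = refl
^-distribʳ-* m n (suc k) = trans (cong (m * n *_) (^-distribʳ-* m n k)) (interchange m n (m ^ k) (n ^ k))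
  where interchange : ∀ m n a c → m * n * (a * c) ≡ m * a * (n * c)
        interchange = solve-∀

rising : ℕ → ℕ → ℕ
rising k zero    = 1
rising k (suc n) = rising k n * (k + n)

rising-suc : ∀ k n → rising k (suc n) ≡ k * rising (suc k) n
rising-suc k zero    = base k
  where base : ∀ k → 1 * (k + 0) ≡ k * 1
        base = solve-∀
rising-suc k (suc n) = begin
  rising k (suc n) * (k + suc n)         ≡⟨ cong (_* (k + suc n)) (rising-suc k n) ⟩
  k * rising (suc k) n * (k + suc n)     ≡⟨ reassoc k (rising (suc k) n) n ⟩
  k * (rising (suc k) n * (suc k + n))   ∎
  where open ≡-Reasoning
        reassoc : ∀ k r n → k * r * (k + suc n) ≡ k * (r * (suc k + n))
        reassoc = solve-∀

rising-pascal : ∀ k n → rising (suc k) (suc n) ≡ rising k (suc n) + suc n * rising (suc k) n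
rising-pascal k n = begin
  rising (suc k) n * (suc k + n)              ≡⟨ distrib k n (rising (suc k) n) ⟩
  k * rising (suc k) n + suc n * rising (suc k) n ≡⟨ cong (_+ suc n * rising (suc k) n) (sym (rising-suc k n)) ⟩
  rising k (suc n) + suc n * rising (suc k) n  ∎
  where open ≡-Reasoning
        distrib : ∀ k n r → r * (suc k + n) ≡ k * r + suc n * r
        distrib = solve-∀

rising-zero : ∀ n → rising 0 (suc n) ≡ 0
rising-zero zero    = refl
rising-zero (suc n) = cong (_* suc n) (rising-zero n)

^≤rising : ∀ k n → k ^ n ≤ rising k n
^≤rising k zero    = ≤-refl
^≤rising k (suc n) = begin
  k * k ^ n        ≡⟨ *-comm k (k ^ n) ⟩
  k ^ n * k        ≤⟨ *-mono-≤ (^≤rising k n) (m≤m+n k n) ⟩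
  rising k n * (k + n) ∎
  where open ≤-Reasoning

-- negBin b K k N = N! L^N Σ_{j ≤ N} (rising k j / j!) (b/L)^j with L = b + K: the N-th partial
-- sum of the binomial series of (1 - b/L)^(-k) = (L/K)^k, cleared of denominators.
module _ (b K : ℕ) where

  private
    L = b + K

  negBin : ℕ → ℕ → ℕ
  negBin k zero    = 1
  negBin k (suc N) = suc N * L * negBin k N + rising k (suc N) * b ^ suc N

  negBin-pascal : ∀ k N → negBin (suc k) (suc N) ≡ negBin k (suc N) + suc N * b * negBin (suc k) N
  negBin-pascal k zero = base k L b
    where base : ∀ k L b → 1 * L * 1 + (1 * (suc k + 0)) * (b * 1) ≡ 1 * L * 1 + (1 * (k + 0)) * (b * 1) + 1 * b * 1
          base = solve-∀
  negBin-pascal k (suc N) = begin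
    suc (suc N) * L * negBin (suc k) (suc N) + rising (suc k) (suc (suc N)) * b ^ suc (suc N)
      ≡⟨ cong₂ (λ u w → suc (suc N) * L * u + w * b ^ suc (suc N)) (negBin-pascal k N) (rising-pascal k (suc N)) ⟩
    suc (suc N) * L * (negBin k (suc N) + suc N * b * negBin (suc k) N)
      + (rising k (suc (suc N)) + suc (suc N) * rising (suc k) (suc N)) * b ^ suc (suc N)
      ≡⟨ regroup (negBin k (suc N)) (negBin (suc k) N) (rising k (suc (suc N))) (rising (suc k) (suc N)) (b ^ suc N) N L b ⟩
    suc (suc N) * L * negBin k (suc N) + rising k (suc (suc N)) * b ^ suc (suc N)
      + suc (suc N) * b * (suc N * L * negBin (suc k) N + rising (suc k) (suc N) * b ^ suc N) ∎
    where open ≡-Reasoning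
          regroup : ∀ y₁ y₂ r₁ r₂ p N L b →
            (2 + N) * L * (y₁ + (1 + N) * b * y₂) + (r₁ + (2 + N) * r₂) * (b * p)
              ≡ (2 + N) * L * y₁ + r₁ * (b * p) + (2 + N) * b * ((1 + N) * L * y₂ + r₂ * p)
          regroup = solve-∀

  negBin-zero : ∀ N → negBin 0 N ≡ N ! * L ^ N
  negBin-zero zero    = refl
  negBin-zero (suc N) = begin
    suc N * L * negBin 0 N + rising 0 (suc N) * b ^ suc N
      ≡⟨ cong₂ (λ u w → suc N * L * u + w * b ^ suc N) (negBin-zero N) (rising-zero N) ⟩
    suc N * L * (N ! * L ^ N) + 0
      ≡⟨ regroup (suc N) L (N !) (L ^ N) ⟩
    suc N * N ! * (L * L ^ N) ∎
    where open ≡-Reasoning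
          regroup : ∀ a L f p → a * L * (f * p) + 0 ≡ a * f * (L * p)
          regroup = solve-∀

  negBin-step : ∀ k N → K * negBin (suc k) N ≤ L * negBin k N
  negBin-step k zero    = *-monoˡ-≤ 1 (m≤n+m K b)
  negBin-step k (suc N) = begin
    K * negBin (suc k) (suc N)
      ≡⟨ cong (K *_) (negBin-pascal k N) ⟩
    K * (negBin k (suc N) + suc N * b * negBin (suc k) N)
      ≡⟨ distrib K (negBin k (suc N)) (suc N) b (negBin (suc k) N) ⟩
    K * negBin k (suc N) + suc N * b * (K * negBin (suc k) N)
      ≤⟨ +-monoʳ-≤ (K * negBin k (suc N)) (*-monoʳ-≤ (suc N * b) (negBin-step k N)) ⟩
    K * negBin k (suc N) + suc N * b * (L * negBin k N)
      ≡⟨ cong (K * negBin k (suc N) +_) (reassoc (suc N) b L (negBin k N)) ⟩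
    K * negBin k (suc N) + b * (suc N * L * negBin k N)
      ≤⟨ +-monoʳ-≤ (K * negBin k (suc N)) (*-monoʳ-≤ b (m≤m+n _ _)) ⟩
    K * negBin k (suc N) + b * negBin k (suc N)
      ≡⟨ sym (*-distribʳ-+ (negBin k (suc N)) K b) ⟩
    (K + b) * negBin k (suc N)
      ≡⟨ cong (_* negBin k (suc N)) (+-comm K b) ⟩
    L * negBin k (suc N) ∎
    where open ≤-Reasoning
          distrib : ∀ a y n b z → a * (y + n * b * z) ≡ a * y + n * b * (a * z)
          distrib = solve-∀
          reassoc : ∀ n b L y → n * b * (L * y) ≡ b * (n * L * y)
          reassoc = solve-∀

  negBin-bound : ∀ k N → K ^ k * negBin k N ≤ L ^ k * (N ! * L ^ N)
  negBin-bound zero    N = ≤-reflexive (cong (_+ 0) (negBin-zero N))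
  negBin-bound (suc k) N = begin
    K * K ^ k * negBin (suc k) N       ≡⟨ *-assoc K (K ^ k) _ ⟩
    K * (K ^ k * negBin (suc k) N)     ≡⟨ x∙yz≡y∙xz K (K ^ k) _ ⟩
    K ^ k * (K * negBin (suc k) N)     ≤⟨ *-monoʳ-≤ (K ^ k) (negBin-step k N) ⟩
    K ^ k * (L * negBin k N)           ≡⟨ x∙yz≡y∙xz (K ^ k) L _ ⟩
    L * (K ^ k * negBin k N)           ≤⟨ *-monoʳ-≤ L (negBin-bound k N) ⟩
    L * (L ^ k * (N ! * L ^ N))        ≡⟨ *-assoc L (L ^ k) _ ⟨
    L * L ^ k * (N ! * L ^ N)          ∎
    where open ≤-Reasoning
          x∙yz≡y∙xz : ∀ x y z → x * (y * z) ≡ y * (x * z)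
          x∙yz≡y∙xz = solve-∀

  S≤negBin : ∀ N → S b N * L ^ N ≤ negBin L N
  S≤negBin zero    = ≤-refl
  S≤negBin (suc N) = begin
    (suc N * S b N + b ^ suc N) * (L * L ^ N)
      ≡⟨ distrib (suc N) (S b N) (b ^ suc N) L (L ^ N) ⟩
    suc N * L * (S b N * L ^ N) + L ^ suc N * b ^ suc N
      ≤⟨ +-mono-≤ (*-monoʳ-≤ (suc N * L) (S≤negBin N)) (*-monoˡ-≤ (b ^ suc N) (^≤rising L (suc N))) ⟩
    suc N * L * negBin L N + rising L (suc N) * b ^ suc N ∎
    where open ≤-Reasoning
          distrib : ∀ n s p L l → (n * s + p) * (L * l) ≡ n * L * (s * l) + L * l * p
          distrib = solve-∀

ExpCond⇒pow-bound : ∀ {b q} → 1 ≤ b → ExpCond b q → ∀ K → b ^ (2 * q) * K ^ (b + K) ≤ (b + K) ^ (b + K)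
ExpCond⇒pow-bound {b@(suc _)} {q} _ (N , b^2q·N!≤S) K =
  *-cancelʳ-≤ _ _ (N ! * L ^ N) {{m*n≢0 (N !) (L ^ N) {{N !≢0}} {{m^n≢0 L N}}}} (begin
    b ^ (2 * q) * K ^ L * (N ! * L ^ N)   ≡⟨ reassoc (b ^ (2 * q)) (K ^ L) (N !) (L ^ N) ⟩
    K ^ L * (b ^ (2 * q) * N ! * L ^ N)   ≤⟨ *-monoʳ-≤ (K ^ L) (*-monoˡ-≤ (L ^ N) b^2q·N!≤S) ⟩
    K ^ L * (S b N * L ^ N)               ≤⟨ *-monoʳ-≤ (K ^ L) (S≤negBin b K N) ⟩
    K ^ L * negBin b K L N                ≤⟨ negBin-bound b K L N ⟩
    L ^ L * (N ! * L ^ N)                 ∎)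
  where
  open ≤-Reasoning
  L = b + K
  reassoc : ∀ p x f l → p * x * (f * l) ≡ x * (p * f * l)
  reassoc = solve-∀

ExpCond⇒b^2q≤2^2b : ∀ {b q} → 1 ≤ b → ExpCond b q → b ^ (2 * q) ≤ 2 ^ (b + b)
ExpCond⇒b^2q≤2^2b {b@(suc _)} {q} 1≤b cond = *-cancelʳ-≤ _ _ (b ^ (b + b)) {{m^n≢0 b (b + b)}} (begin
  b ^ (2 * q) * b ^ (b + b)      ≤⟨ ExpCond⇒pow-bound {q = q} 1≤b cond b ⟩
  (b + b) ^ (b + b)              ≡⟨ cong (_^ (b + b)) (+-*-double b) ⟩
  (2 * b) ^ (b + b)              ≡⟨ ^-distribʳ-* 2 b (b + b) ⟩
  2 ^ (b + b) * b ^ (b + b)      ∎)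
  where
  open ≤-Reasoning
  +-*-double : ∀ b → b + b ≡ 2 * b
  +-*-double = solve-∀

ExpCond⇒2Q≤b : ∀ {b Q} → 2 ≤ b → 2 ≤ Q → ExpCond b (suc Q) → 2 * Q ≤ b
ExpCond⇒2Q≤b {b@(suc _)} {Q} 2≤b 2≤Q cond with 4 ≤? b
... | yes 4≤b = ≤-trans (*-monoʳ-≤ 2 (n≤1+n Q)) (≮⇒≥ λ b<2q → <⇒≱ (^-monoʳ-< 2 ≤-refl (+-mono-< b<2q b<2q)) (begin
  2 ^ (2 * q + 2 * q)           ≡⟨ ^-distribˡ-+-* 2 (2 * q) (2 * q) ⟩
  2 ^ (2 * q) * 2 ^ (2 * q)     ≡⟨ ^-distribʳ-* 2 2 (2 * q) ⟨
  4 ^ (2 * q)                   ≤⟨ ^-monoˡ-≤ (2 * q) 4≤b ⟩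
  b ^ (2 * q)                   ≤⟨ b^2q≤4^b ⟩
  2 ^ (b + b)                   ∎))
  where
  open ≤-Reasoning
  q = suc Q
  b^2q≤4^b = ExpCond⇒b^2q≤2^2b {q = suc Q} (≤-trans (s≤s z≤n) 2≤b) cond
... | no b≱4 = contradiction (≤-trans b^6≤b^2q (ExpCond⇒b^2q≤2^2b {q = suc Q} (≤-trans (s≤s z≤n) 2≤b) cond)) (small b 2≤b (≰⇒> b≱4))
  where
  b^6≤b^2q : b ^ 6 ≤ b ^ (2 * suc Q)
  b^6≤b^2q = ^-monoʳ-≤ b (*-monoʳ-≤ 2 (s≤s 2≤Q))
  small : ∀ b → 2 ≤ b → b < 4 → b ^ 6 ≰ 2 ^ (b + b)
  small 1 (s≤s ()) _
  small 2 _ _ = <⇒≱ (m≤m+n 17 47)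
  small 3 _ _ = <⇒≱ (m≤m+n 65 664)
  small (suc (suc (suc (suc _)))) _ (s≤s (s≤s (s≤s (s≤s ()))))

-- With q = 3 + t colours, m = b(q-1) and r = m - b + 1, this says m (r/m)^b ≤ 1.
ExpCond⇒contraction : ∀ {b} t → 2 ≤ b → ExpCond b (3 + t) →
                      b * (2 + t) * (b * (1 + t) + 1) ^ b ≤ (b * (2 + t)) ^ b
ExpCond⇒contraction {b@(suc _)} t 2≤b cond =
  ≮⇒≥ λ m^b<m·r^b → <⇒≱ (m^L<b^2q·r^L m^b<m·r^b) b^2q·r^L≤m^L
  where
  P = 1 + t
  Q = 2 + t
  q = 3 + t
  m = b * Q
  r = b * P + 1
  K = 2 + (P + b * P)
  L = b + K

  2Q≤b : 2 * Q ≤ b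
  2Q≤b = ExpCond⇒2Q≤b 2≤b (s≤s (s≤s z≤n)) cond

  P+2≤b : P + 2 ≤ b
  P+2≤b = ≤-trans (m≤m+n (P + 2) P) (≤-trans (≤-reflexive (double t)) 2Q≤b)
    where double : ∀ t → (1 + t) + 2 + (1 + t) ≡ 2 * (2 + t)
          double = solve-∀

  Lr≤mK : L * r ≤ m * K
  Lr≤mK = +-cancelʳ-≤ b (L * r) (m * K) (begin
    L * r + b          ≡⟨ expand b t ⟩
    m * K + (P + 2)    ≤⟨ +-monoʳ-≤ (m * K) P+2≤b ⟩
    m * K + b          ∎)
    where open ≤-Reasoning
          expand : ∀ b t → (b + (2 + ((1 + t) + b * (1 + t)))) * (b * (1 + t) + 1) + b
                             ≡ b * (2 + t) * (2 + ((1 + t) + b * (1 + t))) + ((1 + t) + 2)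
          expand = solve-∀

  b^2q·r^L≤m^L : b ^ (2 * q) * r ^ L ≤ m ^ L
  b^2q·r^L≤m^L = *-cancelʳ-≤ _ _ (K ^ L) {{m^n≢0 K L}} (begin
    b ^ (2 * q) * r ^ L * K ^ L    ≡⟨ swap (b ^ (2 * q)) (r ^ L) (K ^ L) ⟩
    b ^ (2 * q) * K ^ L * r ^ L    ≤⟨ *-monoˡ-≤ (r ^ L) (ExpCond⇒pow-bound {q = q} (s≤s z≤n) cond K) ⟩
    L ^ L * r ^ L                  ≡⟨ ^-distribʳ-* L r L ⟨
    (L * r) ^ L                    ≤⟨ ^-monoˡ-≤ L Lr≤mK ⟩
    (m * K) ^ L                    ≡⟨ ^-distribʳ-* m K L ⟩
    m ^ L * K ^ L                  ∎)
    where open ≤-Reasoning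
          swap : ∀ x y z → x * y * z ≡ x * z * y
          swap = solve-∀

  m≤2r : m ≤ 2 * r
  m≤2r = ≤-trans (m≤m+n m (b * t + 2)) (≤-reflexive (expand b t))
    where expand : ∀ b t → b * (2 + t) + (b * t + 2) ≡ 2 * (b * (1 + t) + 1)
          expand = solve-∀

  m^Q·2^[Q+1]≤b^2q : m ^ Q * 2 ^ suc Q ≤ b ^ (2 * q)
  m^Q·2^[Q+1]≤b^2q = begin
    (b * Q) ^ Q * 2 ^ suc Q             ≡⟨ cong (_* 2 ^ suc Q) (^-distribʳ-* b Q Q) ⟩
    b ^ Q * Q ^ Q * (2 * 2 ^ Q)         ≡⟨ regroup (b ^ Q) (Q ^ Q) (2 ^ Q) ⟩
    2 * (b ^ Q * (2 ^ Q * Q ^ Q))       ≡⟨ cong (λ z → 2 * (b ^ Q * z)) (^-distribʳ-* 2 Q Q) ⟨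
    2 * (b ^ Q * (2 * Q) ^ Q)           ≤⟨ *-mono-≤ (≤-trans 2≤b (m≤m*n b b)) (*-monoʳ-≤ (b ^ Q) (^-monoˡ-≤ Q 2Q≤b)) ⟩
    b * b * (b ^ Q * b ^ Q)             ≡⟨ cong (b * b *_) (^-distribˡ-+-* b Q Q) ⟨
    b * b * b ^ (Q + Q)                 ≡⟨ *-assoc b b _ ⟩
    b ^ (2 + (Q + Q))                   ≡⟨ cong (b ^_) (double t) ⟩
    b ^ (2 * q)                         ∎
    where open ≤-Reasoning
          regroup : ∀ x y z → x * y * (2 * z) ≡ 2 * (x * (z * y))
          regroup = solve-∀
          double : ∀ t → 2 + ((2 + t) + (2 + t)) ≡ 2 * (3 + t)
          double = solve-∀

  -- if m (r/m)^b > 1 then (r/m)^L > m^(-Q) (r/m)^(Q+1) ≥ m^(-Q) 2^(-Q-1) ≥ b^(-2q), since L = bQ + Q + 1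
  m^L<b^2q·r^L : m ^ b < m * r ^ b → m ^ L < b ^ (2 * q) * r ^ L
  m^L<b^2q·r^L m^b<m·r^b = begin-strict
    m ^ L                                         ≡⟨ cong (m ^_) (L≡bQ+Q+1 b t) ⟩
    m ^ (b * Q + suc Q)                           ≡⟨ ^-distribˡ-+-* m (b * Q) (suc Q) ⟩
    m ^ (b * Q) * m ^ suc Q                       ≡⟨ cong (_* m ^ suc Q) (^-*-assoc m b Q) ⟨
    (m ^ b) ^ Q * m ^ suc Q                       <⟨ *-monoˡ-< (m ^ suc Q) {{m^n≢0 m (suc Q)}} (^-monoˡ-< Q m^b<m·r^b) ⟩
    (m * r ^ b) ^ Q * m ^ suc Q                   ≤⟨ *-monoʳ-≤ ((m * r ^ b) ^ Q) (^-monoˡ-≤ (suc Q) m≤2r) ⟩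
    (m * r ^ b) ^ Q * (2 * r) ^ suc Q             ≡⟨ cong₂ _*_ (^-distribʳ-* m (r ^ b) Q) (^-distribʳ-* 2 r (suc Q)) ⟩
    m ^ Q * (r ^ b) ^ Q * (2 ^ suc Q * r ^ suc Q) ≡⟨ cong (λ z → m ^ Q * z * (2 ^ suc Q * r ^ suc Q)) (^-*-assoc r b Q) ⟩
    m ^ Q * r ^ (b * Q) * (2 ^ suc Q * r ^ suc Q) ≡⟨ interchange (m ^ Q) (r ^ (b * Q)) (2 ^ suc Q) (r ^ suc Q) ⟩
    m ^ Q * 2 ^ suc Q * (r ^ (b * Q) * r ^ suc Q) ≡⟨ cong (m ^ Q * 2 ^ suc Q *_) (^-distribˡ-+-* r (b * Q) (suc Q)) ⟨
    m ^ Q * 2 ^ suc Q * r ^ (b * Q + suc Q)       ≤⟨ *-monoˡ-≤ (r ^ (b * Q + suc Q)) m^Q·2^[Q+1]≤b^2q ⟩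
    b ^ (2 * q) * r ^ (b * Q + suc Q)             ≡⟨ cong (λ z → b ^ (2 * q) * r ^ z) (L≡bQ+Q+1 b t) ⟨
    b ^ (2 * q) * r ^ L                           ∎
    where open ≤-Reasoning
          L≡bQ+Q+1 : ∀ b t → b + (2 + ((1 + t) + b * (1 + t))) ≡ b * (2 + t) + suc (2 + t)
          L≡bQ+Q+1 = solve-∀
          interchange : ∀ x y z w → x * y * (z * w) ≡ x * z * (y * w)
          interchange = solve-∀


-- Forced roots of proper colourings

module Colourings (Q b : ℕ) where

  Colouring : ℕ → Set
  Colouring = Col (suc Q) b

  properRootIs : ∀ h → Fin (suc Q) → Colouring h → Bool
  properRootIs h c x = proper h x ∧ root x == c

  properBelow : ∀ h → Fin (suc Q) → Colouring h → Bool
  properBelow h c y = not (c == root y) ∧ proper h y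

  childVectors : ∀ h → List (Vec (Colouring h) b)
  childVectors h = allVecs {suc Q} {b} (allCol h) b

  properV≡allᵇ : ∀ h c {n} (cs : Vec (Colouring h) n) → properV h c cs ≡ allᵇ (properBelow h c) cs
  properV≡allᵇ h c []       = refl
  properV≡allᵇ h c (x ∷ cs) = trans (cong (λ z → not (c == root x) ∧ (proper h x ∧ z)) (properV≡allᵇ h c cs))
                                     (sym (∧-assoc (not (c == root x)) (proper h x) (allᵇ (properBelow h c) cs)))

  count-properRootIs-node : ∀ h c (R : Colouring (suc h) → Bool) →
    count (λ x → properRootIs (suc h) c x ∧ R x) (allCol (suc h))
      ≡ count (λ cs → properV h c cs ∧ R (node c cs)) (childVectors h)
  count-properRootIs-node h c R = begin
    count (λ x → properRootIs (suc h) c x ∧ R x) (allCol (suc h))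
      ≡⟨ count-concatMap {g = λ c₀ → map (node c₀) (childVectors h)} (_== c) K fiber (allFin (suc Q)) ⟩
    count (_== c) (allFin (suc Q)) * K  ≡⟨ cong (_* K) (count-==-allFin c) ⟩
    1 * K                               ≡⟨ *-identityˡ K ⟩
    K                                   ∎
    where
    open ≡-Reasoning
    K = count (λ cs → properV h c cs ∧ R (node c cs)) (childVectors h)
    fiber : ∀ c₀ → count (λ x → properRootIs (suc h) c x ∧ R x) (map (node c₀) (childVectors h))
                     ≡ (if c₀ == c then K else 0)
    fiber c₀ = trans (count-map (node c₀) (childVectors h)) (restrict (c₀ ≟ c))
      where
      restrict : (d : Dec (c₀ ≡ c)) →
        count (λ cs → (properV h c₀ cs ∧ does d) ∧ R (node c₀ cs)) (childVectors h)
          ≡ (if does d then K else 0)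
      restrict (yes refl) = count-cong (λ cs → cong (_∧ R (node c cs)) (∧-identityʳ (properV h c cs))) (childVectors h)
      restrict (no _)     = trans (count-cong (λ cs → cong (_∧ R (node c₀ cs)) (∧-zeroʳ (properV h c₀ cs))) (childVectors h))
                                  (count-false (childVectors h))

  count-properBelow-rootIs : ∀ h c c' (f : Colouring h → Bool) (xs : List (Colouring h)) →
    count (λ y → (properBelow h c y ∧ f y) ∧ root y == c') xs
      ≡ (if c == c' then 0 else count (λ y → properRootIs h c' y ∧ f y) xs)
  count-properBelow-rootIs h c c' f xs = begin
    count (λ y → (properBelow h c y ∧ f y) ∧ root y == c') xs
      ≡⟨ count-cong (λ y → pointwise y c') xs ⟩
    count (λ y → not (c == c') ∧ (properRootIs h c' y ∧ f y)) xs
      ≡⟨ count-∧ˡ (not (c == c')) (λ y → properRootIs h c' y ∧ f y) xs ⟩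
    (if not (c == c') then count (λ y → properRootIs h c' y ∧ f y) xs else 0)
      ≡⟨ if-not (c == c') ⟩
    (if c == c' then 0 else count (λ y → properRootIs h c' y ∧ f y) xs) ∎
    where
    open ≡-Reasoning
    pointwise : ∀ y c' → ((not (c == root y) ∧ proper h y) ∧ f y) ∧ root y == c'
                          ≡ not (c == c') ∧ ((proper h y ∧ root y == c') ∧ f y)
    pointwise y c' with root y ≟ c'
    ... | yes refl = shuffle (not (c == root y)) (proper h y) (f y)
      where shuffle : ∀ a p e → ((a ∧ p) ∧ e) ∧ true ≡ a ∧ ((p ∧ true) ∧ e)
            shuffle false p     e = refl
            shuffle true  false e = refl
            shuffle true  true  e = ∧-identityʳ e
    ... | no _     = absorb (not (c == c')) (proper h y) (f y)
      where absorb : ∀ a p e → ((not (c == root y) ∧ p) ∧ e) ∧ false ≡ a ∧ ((p ∧ false) ∧ e)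
            absorb a p e = trans (∧-zeroʳ _) (sym (trans (cong (λ z → a ∧ (z ∧ e)) (∧-zeroʳ p)) (∧-zeroʳ a)))
    if-not : ∀ e {x} → (if not e then x else 0) ≡ (if e then 0 else x)
    if-not true  = refl
    if-not false = refl

  ω : ℕ → ℕ
  ω zero    = 1
  ω (suc h) = (Q * ω h) ^ b

  count-properBelow≡Qω : ∀ h c → count (properBelow h c) (allCol h) ≡ Q * ω h

  count-properRootIs≡ω : ∀ h c → count (properRootIs h c) (allCol h) ≡ ω h
  count-properRootIs≡ω zero    c = trans (count-map leaf (allFin (suc Q))) (count-==-allFin c)
  count-properRootIs≡ω (suc h) c = begin
    count (properRootIs (suc h) c) (allCol (suc h))
      ≡⟨ count-cong (λ x → sym (∧-identityʳ (properRootIs (suc h) c x))) (allCol (suc h)) ⟩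
    count (λ x → properRootIs (suc h) c x ∧ true) (allCol (suc h))
      ≡⟨ count-properRootIs-node h c (λ _ → true) ⟩
    count (λ cs → properV h c cs ∧ true) (childVectors h)
      ≡⟨ count-cong (λ cs → trans (∧-identityʳ (properV h c cs)) (properV≡allᵇ h c cs)) (childVectors h) ⟩
    count (allᵇ (properBelow h c)) (childVectors h)
      ≡⟨ count-allVecs-allᵇ {q = suc Q} {b} (properBelow h c) (allCol h) b ⟩
    count (properBelow h c) (allCol h) ^ b
      ≡⟨ cong (_^ b) (count-properBelow≡Qω h c) ⟩
    (Q * ω h) ^ b ∎
    where open ≡-Reasoning

  count-properBelow≡Qω h c = begin
    count (properBelow h c) (allCol h)
      ≡⟨ count-byKey root (properBelow h c) (allCol h) ⟩
    ∑[ c' < suc Q ] count (λ y → properBelow h c y ∧ root y == c') (allCol h)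
      ≡⟨ sum-cong-≗ term ⟩
    ∑[ c' < suc Q ] (if c == c' then 0 else ω h)
      ≡⟨ ∑-punctured c 0 (ω h) ⟩
    Q * ω h ∎
    where
    open ≡-Reasoning
    term : ∀ c' → count (λ y → properBelow h c y ∧ root y == c') (allCol h) ≡ (if c == c' then 0 else ω h)
    term c' = begin
      count (λ y → properBelow h c y ∧ root y == c') (allCol h)
        ≡⟨ count-cong (λ y → cong (_∧ root y == c') (sym (∧-identityʳ (properBelow h c y)))) (allCol h) ⟩
      count (λ y → (properBelow h c y ∧ true) ∧ root y == c') (allCol h)
        ≡⟨ count-properBelow-rootIs h c c' (λ _ → true) (allCol h) ⟩
      (if c == c' then 0 else count (λ y → properRootIs h c' y ∧ true) (allCol h))
        ≡⟨ cong (if c == c' then 0 else_) (count-cong (λ y → ∧-identityʳ (properRootIs h c' y)) (allCol h)) ⟩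
      (if c == c' then 0 else count (properRootIs h c') (allCol h))
        ≡⟨ cong (if c == c' then 0 else_) (count-properRootIs≡ω h c') ⟩
      (if c == c' then 0 else ω h) ∎

  length-leaves : ∀ h (y : Colouring h) → length (leaves h y) ≡ b ^ h
  length-leavesV : ∀ h {n} (cs : Vec (Colouring h) n) → length (leavesV h cs) ≡ n * b ^ h
  length-leaves zero    (leaf _)    = refl
  length-leaves (suc h) (node _ cs) = length-leavesV h cs
  length-leavesV h []       = refl
  length-leavesV h (x ∷ cs) = trans (length-++ (leaves h x)) (cong₂ _+_ (length-leaves h x) (length-leavesV h cs))

  allCol-complete : ∀ h (y : Colouring h) → y ∈ allCol h
  allCol-complete zero    (leaf c)    = ∈-map⁺ leaf (∈-allFin c)
  allCol-complete (suc h) (node c cs) =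
    ∈-concatMap⁺ (λ c₀ → map (node c₀) (childVectors h))
      (lose {P = λ c₀ → node c cs ∈ map (node c₀) (childVectors h)} (∈-allFin c)
            (∈-map⁺ (node c) (allVecs-complete {q = suc Q} {b} (allCol-complete h) cs)))

  forced⇒root≡ : ∀ h {x y : Colouring h} → forced h x ≡ true → proper h y ≡ true →
                 leaves h y ≡ leaves h x → root y ≡ root x
  forced⇒root≡ h {x} {y} x-forced y-proper same-leaves =
    ==⇒≡ (subst (λ d → not d ∨ (root y == root x) ≡ true) (dec-true (≡-dec _≟_ (leaves h y) (leaves h x)) same-leaves)
                (foldr-∧-true⇒∈ _ x-forced y∈Ω))
    where
    y∈Ω : y ∈ Ω h
    y∈Ω = ∈-filter⁺ (T? ∘ proper h) (allCol-complete h y) (Equivalence.from T-≡ y-proper)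

  unforced⇒recolouring : ∀ h {x : Colouring h} → forced h x ≡ false →
    Σ (Colouring h) λ y → proper h y ≡ true × leaves h y ≡ leaves h x × (root y == root x) ≡ false
  unforced⇒recolouring h {x} x-unforced
    with y , y∈Ω , witness ← foldr-∧-false⇒∃ _ (Ω h) x-unforced
    with _ , y-proper ← ∈-filter⁻ (T? ∘ proper h) {xs = allCol h} y∈Ω =
      y , Equivalence.to T-≡ y-proper
        , does⇒ (≡-dec _≟_ (leaves h y) (leaves h x)) (not-injective {y = true} (∨-conicalˡ _ _ witness))
        , ∨-conicalʳ _ _ witness

  leaf-forced : (x : Colouring 0) → forced 0 x ≡ true
  leaf-forced x@(leaf c) with forced 0 x in x-forced
  ... | true  = refl
  ... | false with leaf c′ , _ , same , differ ← unforced⇒recolouring 0 {leaf c} x-forced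
    = contradiction (∷-injectiveˡ same) (==-false⇒≢ differ)

  recolourableBelow : ∀ h → Fin (suc Q) → Fin (suc Q) → Colouring h → Bool
  recolourableBelow h c c' y = properBelow h c y ∧ not (forced h y ∧ root y == c')

  properV-∷⁻ : ∀ h c {n} (x : Colouring h) (cs : Vec (Colouring h) n) → properV h c (x ∷ cs) ≡ true →
               not (c == root x) ≡ true × proper h x ≡ true × properV h c cs ≡ true
  properV-∷⁻ h c x cs ok with not (c == root x) | proper h x | properV h c cs | ok
  ... | true | true | true | _ = refl , refl , refl

  twin⇒not-forced-to : ∀ h c' {x y : Colouring h} → proper h y ≡ true → not (c' == root y) ≡ true →
                       leaves h y ≡ leaves h x → (forced h x ∧ root x == c') ≡ false
  twin⇒not-forced-to h c' {x} {y} y-proper y-not-c' same-leaves with forced h x in x-forced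
  ... | false = refl
  ... | true  = dec-false (root x ≟ c') λ x≡c' →
    contradiction (trans (sym x≡c') (sym (forced⇒root≡ h x-forced y-proper same-leaves)))
                  (==-false⇒≢ (not-injective {y = false} y-not-c'))

  recolourable-children : ∀ h c c' {n} (cs ys : Vec (Colouring h) n) →
    leavesV h ys ≡ leavesV h cs → properV h c cs ≡ true → properV h c' ys ≡ true →
    allᵇ (recolourableBelow h c c') cs ≡ true
  recolourable-children h c c' []       []       _    _      _      = refl
  recolourable-children h c c' (x ∷ cs) (y ∷ ys) same cs-ok ys-ok
    with x-below , x-proper , cs-ok′ ← properV-∷⁻ h c x cs cs-ok
       | y-not-c' , y-proper , ys-ok′ ← properV-∷⁻ h c' y ys ys-ok
       | same-leaves , same-rest ← ++-injective (leaves h y) (leaves h x) (trans (length-leaves h y) (sym (length-leaves h x))) same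
    rewrite x-below | x-proper | twin⇒not-forced-to h c' y-proper y-not-c' same-leaves
    = recolourable-children h c c' cs ys same-rest cs-ok′ ys-ok′

  unforced-node : ∀ h c (cs : Vec (Colouring h) b) → properV h c cs ≡ true → forced (suc h) (node c cs) ≡ false →
    Σ (Fin (suc Q)) λ c' → (c' == c) ≡ false × allᵇ (recolourableBelow h c c') cs ≡ true
  unforced-node h c cs cs-ok unforced with node c' ys , y-proper , same , differ ← unforced⇒recolouring (suc h) {node c cs} unforced
    = c' , differ , recolourable-children h c c' cs ys same cs-ok y-proper

  module _ .{{_ : NonZero b}} (r : ℕ) (bQ+1≡b+r : b * Q + 1 ≡ b + r) (contraction : b * Q * r ^ b ≤ (b * Q) ^ b) where

    #unforced : ∀ h → Fin (suc Q) → ℕ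
    #unforced h c = count (λ x → properRootIs h c x ∧ not (forced h x)) (allCol h)

    -- Of the Q · ω h proper children under colour c, exactly ω h ∸ #unforced h c' are forced to colour c'.
    recolourable-bound : ∀ h c c' → (c == c') ≡ false → b * #unforced h c' ≤ ω h →
                         b * count (recolourableBelow h c c') (allCol h) ≤ r * ω h
    recolourable-bound h c c' c≢c' IH = +-cancelˡ-≤ (b * m) _ _ (begin
      b * m + b * ρ              ≡⟨ cong (λ z → b * z + b * ρ) m≡F+G ⟩
      b * (F + G) + b * ρ        ≡⟨ regroup b F G ρ ⟩
      b * (F + ρ) + b * G        ≡⟨ cong (λ z → b * z + b * G) Qm≡F+ρ ⟨
      b * (Q * m) + b * G        ≤⟨ +-monoʳ-≤ (b * (Q * m)) IH ⟩
      b * (Q * m) + m            ≡⟨ factor b Q m ⟩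
      (b * Q + 1) * m            ≡⟨ cong (_* m) bQ+1≡b+r ⟩
      (b + r) * m                ≡⟨ *-distribʳ-+ m b r ⟩
      b * m + r * m              ∎)
      where
      open ≤-Reasoning
      m = ω h
      ρ = count (recolourableBelow h c c') (allCol h)
      F = count (λ y → properRootIs h c' y ∧ forced h y) (allCol h)
      G = #unforced h c'
      regroup : ∀ b F G ρ → b * (F + G) + b * ρ ≡ b * (F + ρ) + b * G
      regroup = solve-∀
      factor : ∀ b Q m → b * (Q * m) + m ≡ (b * Q + 1) * m
      factor = solve-∀
      m≡F+G : m ≡ F + G
      m≡F+G = trans (sym (count-properRootIs≡ω h c')) (count-split (forced h) (allCol h))
      Qm≡F+ρ : Q * m ≡ F + ρ
      Qm≡F+ρ = begin-equality
        Q * m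
          ≡⟨ count-properBelow≡Qω h c ⟨
        count (properBelow h c) (allCol h)
          ≡⟨ count-split (λ y → forced h y ∧ root y == c') (allCol h) ⟩
        count (λ y → properBelow h c y ∧ (forced h y ∧ root y == c')) (allCol h) + ρ
          ≡⟨ cong (_+ ρ) (count-cong (λ y → sym (∧-assoc (properBelow h c y) (forced h y) (root y == c'))) (allCol h)) ⟩
        count (λ y → (properBelow h c y ∧ forced h y) ∧ root y == c') (allCol h) + ρ
          ≡⟨ cong (_+ ρ) (count-properBelow-rootIs h c c' (forced h) (allCol h)) ⟩
        (if c == c' then 0 else F) + ρ
          ≡⟨ cong (λ e → (if e then 0 else F) + ρ) c≢c' ⟩
        F + ρ ∎

    unforced-bound : ∀ h c → b * #unforced h c ≤ ω h
    unforced-bound zero c = subst (_≤ 1) (sym (trans (cong (b *_) none-unforced) (*-zeroʳ b))) z≤n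
      where
      none-unforced : #unforced zero c ≡ 0
      none-unforced = trans (count-cong (λ x → trans (cong (λ z → properRootIs 0 c x ∧ not z) (leaf-forced x))
                                                      (∧-zeroʳ (properRootIs 0 c x))) (allCol 0))
                            (count-false (allCol {suc Q} {b} 0))
    unforced-bound (suc h) c = *-cancelˡ-≤ (b ^ b) {{m^n≢0 b b}} (begin
      b ^ b * (b * #unforced (suc h) c)                     ≡⟨ cong (λ z → b ^ b * (b * z)) (count-properRootIs-node h c _) ⟩
      b ^ b * (b * U)                                       ≡⟨ x∙yz≈y∙xz (b ^ b) b U ⟩
      b * (b ^ b * U)                                       ≤⟨ *-monoʳ-≤ b (*-monoʳ-≤ (b ^ b) U≤∑) ⟩
      b * (b ^ b * ∑[ c' < suc Q ] T c')                    ≡⟨ cong (b *_) (*-distribˡ-sum (b ^ b) T) ⟩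
      b * ∑[ c' < suc Q ] (b ^ b * T c')                    ≤⟨ *-monoʳ-≤ b (∑-mono-≤ term-bound) ⟩
      b * ∑[ c' < suc Q ] (if c == c' then 0 else (r * m) ^ b) ≡⟨ cong (b *_) (∑-punctured c 0 ((r * m) ^ b)) ⟩
      b * (Q * (r * m) ^ b)                                 ≡⟨ cong (λ z → b * (Q * z)) (^-distribʳ-* r m b) ⟩
      b * (Q * (r ^ b * m ^ b))                             ≡⟨ reassoc b Q (r ^ b) (m ^ b) ⟩
      b * Q * r ^ b * m ^ b                                 ≤⟨ *-monoˡ-≤ (m ^ b) contraction ⟩
      (b * Q) ^ b * m ^ b                                   ≡⟨ cong (_* m ^ b) (^-distribʳ-* b Q b) ⟩
      b ^ b * Q ^ b * m ^ b                                 ≡⟨ *-assoc (b ^ b) (Q ^ b) (m ^ b) ⟩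
      b ^ b * (Q ^ b * m ^ b)                               ≡⟨ cong (b ^ b *_) (^-distribʳ-* Q m b) ⟨
      b ^ b * (Q * m) ^ b                                   ∎)
      where
      open ≤-Reasoning
      m = ω h
      U = count (λ cs → properV h c cs ∧ not (forced (suc h) (node c cs))) (childVectors h)
      T : Fin (suc Q) → ℕ
      T c' = count (λ cs → not (c' == c) ∧ allᵇ (recolourableBelow h c c') cs) (childVectors h)
      U≤∑ : U ≤ ∑[ c' < suc Q ] T c'
      U≤∑ = count-≤-∑ (λ c' cs → not (c' == c) ∧ allᵇ (recolourableBelow h c c') cs) witness (childVectors h)
        where
        witness : ∀ cs → (properV h c cs ∧ not (forced (suc h) (node c cs))) ≡ true →
                  Σ (Fin (suc Q)) λ c' → (not (c' == c) ∧ allᵇ (recolourableBelow h c c') cs) ≡ true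
        witness cs ok with c' , c'≢c , recolourable ← unforced-node h c cs (∧-conicalˡ _ _ ok) (not-injective {y = false} (∧-conicalʳ _ _ ok))
          = c' , cong₂ _∧_ (cong not c'≢c) recolourable
      term-bound : ∀ c' → b ^ b * T c' ≤ (if c == c' then 0 else (r * m) ^ b)
      term-bound c' rewrite ==-sym c' c with c == c' in c≟c'
      ... | true  = ≤-reflexive (trans (cong (b ^ b *_) (count-false (childVectors h))) (*-zeroʳ (b ^ b)))
      ... | false = begin
        b ^ b * count (allᵇ (recolourableBelow h c c')) (childVectors h)
          ≡⟨ cong (b ^ b *_) (count-allVecs-allᵇ {q = suc Q} {b} (recolourableBelow h c c') (allCol h) b) ⟩
        b ^ b * count (recolourableBelow h c c') (allCol h) ^ b
          ≡⟨ ^-distribʳ-* b _ b ⟨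
        (b * count (recolourableBelow h c c') (allCol h)) ^ b
          ≤⟨ ^-monoˡ-≤ b (recolourable-bound h c c' c≟c' (unforced-bound h c')) ⟩
        (r * m) ^ b ∎
      reassoc : ∀ b Q x y → b * (Q * (x * y)) ≡ b * Q * x * y
      reassoc = solve-∀

    unforced-below-bound : ∀ d h (p : Vec (Fin b) d) c →
      b * count (λ x → properRootIs (d + h) c x ∧ not (forced h (sub d p x))) (allCol (d + h)) ≤ ω (d + h)
    unforced-below-bound zero    h []      c = unforced-bound h c
    unforced-below-bound (suc d) h (i ∷ p) c = begin
      b * count (λ x → properRootIs (suc k) c x ∧ not (forced h (sub (suc d) (i ∷ p) x))) (allCol (suc k))
        ≡⟨ cong (b *_) (count-properRootIs-node k c (λ x → not (forced h (sub (suc d) (i ∷ p) x)))) ⟩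
      b * count (λ cs → properV k c cs ∧ bad (lookup cs i)) (childVectors k)
        ≡⟨ cong (b *_) (count-cong (λ cs → cong (_∧ bad (lookup cs i)) (properV≡allᵇ k c cs)) (childVectors k)) ⟩
      b * count (λ cs → allᵇ (properBelow k c) cs ∧ bad (lookup cs i)) (childVectors k)
        ≤⟨ allVecs-lookup-≤ {q = suc Q} {b} (properBelow k c) (allCol k) bad b fraction i ⟩
      count (allᵇ (properBelow k c)) (childVectors k)
        ≡⟨ count-allVecs-allᵇ {q = suc Q} {b} (properBelow k c) (allCol k) b ⟩
      count (properBelow k c) (allCol k) ^ b
        ≡⟨ cong (_^ b) (count-properBelow≡Qω k c) ⟩
      ω (suc k) ∎
      where
      open ≤-Reasoning
      k = d + h
      bad : Colouring k → Bool
      bad y = not (forced h (sub d p y))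
      fraction : b * count (λ y → properBelow k c y ∧ bad y) (allCol k) ≤ count (properBelow k c) (allCol k)
      fraction = begin
        b * count (λ y → properBelow k c y ∧ bad y) (allCol k)
          ≤⟨ *-count-≤-∑ root b (allCol k) per-colour ⟩
        ∑[ c' < suc Q ] (if c == c' then 0 else ω k)
          ≡⟨ ∑-punctured c 0 (ω k) ⟩
        Q * ω k
          ≡⟨ count-properBelow≡Qω k c ⟨
        count (properBelow k c) (allCol k) ∎
        where
        per-colour : ∀ c' → b * count (λ y → (properBelow k c y ∧ bad y) ∧ root y == c') (allCol k)
                              ≤ (if c == c' then 0 else ω k)
        per-colour c' rewrite count-properBelow-rootIs k c c' bad (allCol k) with c == c'
        ... | true  = ≤-reflexive (*-zeroʳ b)
        ... | false = unforced-below-bound d h p c'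

    unforced-fraction : ∀ h d (v : Vec (Fin b) d) →
      b * length (filter (λ x → T? (not (forced h (sub d v x)))) (Ω {suc Q} {b} (d + h))) ≤ length (Ω {suc Q} {b} (d + h))
    unforced-fraction h d v = begin
      b * length (filter (T? ∘ bad) (Ω k))
        ≡⟨ cong (b *_) (trans (length-filter {f = bad} (Ω k)) (count-filter {f = proper k} bad (allCol k))) ⟩
      b * count (λ x → proper k x ∧ bad x) (allCol k)
        ≤⟨ *-count-≤-∑ root b (allCol k) per-colour ⟩
      ∑[ c < suc Q ] ω k
        ≡⟨ sum-cong-≗ (λ c → count-properRootIs≡ω k c) ⟨
      ∑[ c < suc Q ] count (properRootIs k c) (allCol k)
        ≡⟨ count-byKey root (proper k) (allCol k) ⟨
      count (proper k) (allCol k)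
        ≡⟨ length-filter {f = proper k} (allCol k) ⟨
      length (Ω k) ∎
      where
      open ≤-Reasoning
      k = d + h
      bad : Colouring k → Bool
      bad x = not (forced h (sub d v x))
      per-colour : ∀ c → b * count (λ x → (proper k x ∧ bad x) ∧ root x == c) (allCol k) ≤ ω k
      per-colour c = begin
        b * count (λ x → (proper k x ∧ bad x) ∧ root x == c) (allCol k)
          ≡⟨ cong (b *_) (count-cong (λ x → xy∙z≈xz∙y (proper k x) (bad x) (root x == c)) (allCol k)) ⟩
        b * count (λ x → properRootIs k c x ∧ bad x) (allCol k)
          ≤⟨ unforced-below-bound d h v c ⟩
        ω k ∎

lemma8 : (b q : ℕ) → 2 ≤ b → 3 ≤ q → ExpCond b q →
    (h d : ℕ) → (v : Vec (Fin b) d) →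
    b * length (filter (λ x → T? (not (forced h (sub d v x)))) (Ω {q} {b} (d + h)))
      ≤ length (Ω {q} {b} (d + h))
lemma8 b@(suc (suc _)) (suc (suc (suc t))) 2≤b@(s≤s (s≤s _)) (s≤s (s≤s (s≤s _))) cond h d v =
  unforced-fraction (b * (1 + t) + 1) (bQ+1≡b+r b t) (ExpCond⇒contraction t 2≤b cond) h d v
  where
  open Colourings (2 + t) b
  bQ+1≡b+r : ∀ b t → b * (2 + t) + 1 ≡ b + (b * (1 + t) + 1)
  bQ+1≡b+r = solve-∀
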